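{- Let $\omega_0\in\Sigma$, let $\eta=\omega_0$ be the length-one finite trace, and let $\phi$ be an $\textit{LTL}_f$ formula not containing the operator $X_w$. If $\eta\models\phi$ (in $\textit{LTL}_f$ semantics), then $\eta^\omega=\omega_0\omega_0\omega_0\cdots\models\phi$ when $\phi$ is interpreted as an LTL formula over infinite traces.
   Context: Fix a finite set $\mathcal{P}$ of atomic propositions; $L=\mathcal{P}\cup\{\neg a: a\in\mathcal{P}\}$ is the set of literals and $\Sigma=2^{L}$. Formulas are in negation normal form: $\phi::=\mathsf{tt}\mid\mathsf{ff}\mid \ell\mid \phi\wedge\phi\mid\phi\vee\phi\mid X\phi\mid X_w\phi\mid \phi U\phi\mid\phi R\phi$, $\ell\in L$; $X_w$-free formulas are also LTL formulas. $\textit{LTL}_f$ semantics on finite traces $\eta=\omega_0\ldots\omega_n$ ($n\ge 0$, $|\eta|=n+1$, $\eta_i=\omega_i\ldots\omega_n$): $\eta\models\mathsf{tt}$, $\eta\not\models\mathsf{ff}$; $\eta\models\ell$ iff $\ell\in\omega_0$; $\wedge,\vee$ as usual; $\eta\models X\psi$ iff $|\eta|>1$ and $\eta_1\models\psi$; $\eta\models X_w\psi$ iff $|\eta|=1$ or ($|\eta|>1$ and $\eta_1\models\psi$); $\eta\models\phi_1U\phi_2$ iff some $0\le i<|\eta|$ has $\eta_i\models\phi_2$ and $\eta_j\models\phi_1$ for all $j<i$; $\eta\models\phi_1R\phi_2$ iff either $\eta_i\models\phi_2$ for all $0\le i<|\eta|$, or some $0\le i<|\eta|$ has $\eta_i\models\phi_1$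 and $\eta_j\models\phi_2$ for all $j\le i$. LTL semantics on infinite traces $\xi=\omega_0\omega_1\cdots\in\Sigma^\omega$ with suffixes $\xi_i=\omega_i\omega_{i+1}\cdots$: $\xi\models\mathsf{tt}$, $\xi\not\models\mathsf{ff}$; $\xi\models\ell$ iff $\ell\in\omega_0$; $\wedge,\vee$ as usual; $\xi\models X\psi$ iff $\xi_1\models\psi$; $\xi\models\phi_1U\phi_2$ iff some $i\ge0$ has $\xi_i\models\phi_2$ and $\xi_j\models\phi_1$ for all $j<i$; $\xi\models\phi_1R\phi_2$ iff either $\xi_i\models\phi_2$ for all $i\ge 0$, or some $i\ge 0$ has $\xi_i\models\phi_1$ and $\xi_j\models\phi_2$ for all $j\le i$. -}

module Defs where

open import Data.Nat using (ℕ; zero; suc; _+_; _<_; _≤_; _>_)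
open import Data.Fin using (Fin)
open import Data.Bool using (Bool; true; false; T)
open import Data.List using (List; []; _∷_)
open import Data.List.NonEmpty using (List⁺; _∷_; [_]; length; tail)
open import Data.Product using (Σ; _×_; _,_; ∃-syntax)
open import Data.Sum using (_⊎_)
open import Data.Unit using (⊤)
open import Data.Empty using (⊥)
open import Relation.Binary.PropositionalEquality using (_≡_)

data Literal (k : ℕ) : Set where
  pos : Fin k → Literal k
  neg : Fin k → Literal k

-- Σ = 2^L: a letter is a subset of L (characteristic function).
Letter : ℕ → Set
Letter k = Literal k → Bool

-- Formulas in negation normal form.
data Formula (k : ℕ) : Set where
  tt ff : Formula k
  lit   : Literal k → Formula k
  _∧_ _∨_ : Formula k → Formula k → Formula k
  X Xw  : Formula k → Formula k
  _U_ _R_ : Formula k → Formula k → Formula k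

XwFree : ∀ {k} → Formula k → Set
XwFree tt = ⊤
XwFree ff = ⊤
XwFree (lit l) = ⊤
XwFree (φ ∧ ψ) = XwFree φ × XwFree ψ
XwFree (φ ∨ ψ) = XwFree φ × XwFree ψ
XwFree (X φ) = XwFree φ
XwFree (Xw φ) = ⊥
XwFree (φ U ψ) = XwFree φ × XwFree ψ
XwFree (φ R ψ) = XwFree φ × XwFree ψ

FinTrace : ℕ → Set
FinTrace k = List⁺ (Letter k)

-- Suffix η_i (for i < |η|; for larger i it returns the last letter,
-- but only indices i < |η| are ever used).
suffix : ∀ {k} → FinTrace k → ℕ → FinTrace k
suffix η zero = η
suffix (a ∷ []) (suc i) = a ∷ []
suffix (a ∷ b ∷ w) (suc i) = suffix (b ∷ w) i

infix 4 _⊨f_ _⊨ω_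
_⊨f_ : ∀ {k} → FinTrace k → Formula k → Set
η ⊨f tt = ⊤
η ⊨f ff = ⊥
(a ∷ _) ⊨f lit l = T (a l)
η ⊨f (φ ∧ ψ) = (η ⊨f φ) × (η ⊨f ψ)
η ⊨f (φ ∨ ψ) = (η ⊨f φ) ⊎ (η ⊨f ψ)
η ⊨f X φ = (length η > 1) × (suffix η 1 ⊨f φ)
η ⊨f Xw φ = (length η ≡ 1) ⊎ ((length η > 1) × (suffix η 1 ⊨f φ))
η ⊨f (φ U ψ) = ∃[ i ] (i < length η) × (suffix η i ⊨f ψ)
                     × (∀ j → j < i → suffix η j ⊨f φ)
η ⊨f (φ R ψ) = (∀ i → i < length η → suffix η i ⊨f ψ)
             ⊎ (∃[ i ] (i < length η) × (suffix η i ⊨f φ)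
                     × (∀ j → j ≤ i → suffix η j ⊨f ψ))

InfTrace : ℕ → Set
InfTrace k = ℕ → Letter k

suffixω : ∀ {k} → InfTrace k → ℕ → InfTrace k
suffixω ξ i n = ξ (i + n)

-- LTL semantics on infinite traces (Xw is never used for LTL formulas;
-- we give it the X semantics only to make the function total).
_⊨ω_ : ∀ {k} → InfTrace k → Formula k → Set
ξ ⊨ω tt = ⊤
ξ ⊨ω ff = ⊥
ξ ⊨ω lit l = T (ξ 0 l)
ξ ⊨ω (φ ∧ ψ) = (ξ ⊨ω φ) × (ξ ⊨ω ψ)
ξ ⊨ω (φ ∨ ψ) = (ξ ⊨ω φ) ⊎ (ξ ⊨ω ψ)
ξ ⊨ω X φ = suffixω ξ 1 ⊨ω φ
ξ ⊨ω Xw φ = suffixω ξ 1 ⊨ω φ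
ξ ⊨ω (φ U ψ) = ∃[ i ] (suffixω ξ i ⊨ω ψ) × (∀ j → j < i → suffixω ξ j ⊨ω φ)
ξ ⊨ω (φ R ψ) = (∀ i → suffixω ξ i ⊨ω ψ)
             ⊎ (∃[ i ] (suffixω ξ i ⊨ω φ) × (∀ j → j ≤ i → suffixω ξ j ⊨ω ψ))

-- η^ω for the length-one trace η = ω₀: the constant infinite trace.
const-ω : ∀ {k} → Letter k → InfTrace k
const-ω a _ = a

-- On the one-letter trace ω₀ there is no next position: X φ fails, and both
-- φ U ψ and φ R ψ can only be witnessed at position 0, so each reduces to ψ.
-- Conversely every suffix of the constant trace ω₀ω₀ω₀⋯ is that trace again,
-- so ψ on it already yields φ U ψ (witness 0) and φ R ψ (ψ holds everywhere).
module Submission where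

open import Defs
open import Data.Nat using (ℕ; zero; suc; z≤n; s≤s)
open import Data.List.NonEmpty using ([_])
open import Data.Product using (_,_)
open import Data.Sum using (inj₁; inj₂)
open import Data.Unit using (tt)
open import Data.Empty using (⊥-elim)
open import Relation.Nullary using (¬_)

singleton-⊭X : ∀ {k} {a : Letter k} {φ} → ¬ ([ a ] ⊨f X φ)
singleton-⊭X (s≤s () , _)

module _ {k : ℕ} {a : Letter k} (φ ψ : Formula k) where

  singleton-⊨U⇒⊨ʳ : [ a ] ⊨f φ U ψ → [ a ] ⊨f ψ
  singleton-⊨U⇒⊨ʳ (zero  , _ , ψ-holds , _) = ψ-holds
  singleton-⊨U⇒⊨ʳ (suc _ , s≤s () , _)

  singleton-⊨R⇒⊨ʳ : [ a ] ⊨f φ R ψ → [ a ] ⊨f ψ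
  singleton-⊨R⇒⊨ʳ (inj₁ always-ψ)                 = always-ψ 0 (s≤s z≤n)
  singleton-⊨R⇒⊨ʳ (inj₂ (zero  , _ , _ , ψ-upto)) = ψ-upto 0 z≤n
  singleton-⊨R⇒⊨ʳ (inj₂ (suc _ , s≤s () , _))

  const-⊨ʳ⇒⊨U : const-ω a ⊨ω ψ → const-ω a ⊨ω φ U ψ
  const-⊨ʳ⇒⊨U ψ-holds = 0 , ψ-holds , λ _ ()

  const-⊨ʳ⇒⊨R : const-ω a ⊨ω ψ → const-ω a ⊨ω φ R ψ
  const-⊨ʳ⇒⊨R ψ-holds = inj₁ (λ _ → ψ-holds)

lemma3 : (k : ℕ) (ω₀ : Letter k) (φ : Formula k) → XwFree φ →
    [ ω₀ ] ⊨f φ → const-ω ω₀ ⊨ω φ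
lemma3 k a tt      _         _         = tt
lemma3 k a ff      _         ()
lemma3 k a (lit l) _         h         = h
lemma3 k a (φ ∧ ψ) (fφ , fψ) (hφ , hψ) = lemma3 k a φ fφ hφ , lemma3 k a ψ fψ hψ
lemma3 k a (φ ∨ ψ) (fφ , _)  (inj₁ h)  = inj₁ (lemma3 k a φ fφ h)
lemma3 k a (φ ∨ ψ) (_  , fψ) (inj₂ h)  = inj₂ (lemma3 k a ψ fψ h)
lemma3 k a (X φ)   _         h         = ⊥-elim (singleton-⊭X {φ = φ} h)
lemma3 k a (Xw φ)  ()        _
lemma3 k a (φ U ψ) (_  , fψ) h         =
  const-⊨ʳ⇒⊨U φ ψ (lemma3 k a ψ fψ (singleton-⊨U⇒⊨ʳ φ ψ h))
lemma3 k a (φ R ψ) (_  , fψ) h         =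
  const-⊨ʳ⇒⊨R φ ψ (lemma3 k a ψ fψ (singleton-⊨R⇒⊨ʳ φ ψ h))
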